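{- Let $k\geq 2$ and $n\geq 0$. The map assigning to each $k$-Catalan path $P$ of order $n$ the short $k$-Catalan--Spitzer permutation induced by $P$ is injective.
   Context: A $k$-Catalan path of order $n$ is a lattice path from $(0,0)$ to $(kn,0)$ consisting of $(k-1)n$ up steps $(1,1)$ and $n$ down steps $(1,1-k)$ never going below the $x$-axis; the level of an up step is the $y$-coordinate of its starting point. The short $k$-Catalan--Spitzer permutation induced by $P$ is obtained by labeling the up steps of $P$ bijectively with $1,\ldots,(k-1)n$ so that labels increase from right to left among up steps at the same level and every up step at a lower level gets a smaller label than every up step at a higher level, and recording the labels in the order the up steps occur along $P$. -}

module Defs where

open import Data.Nat using (ℕ; zero; suc; _+_; _*_; _∸_; _≤_; _<_; _<ᵇ_; _≡ᵇ_)
open import Data.Bool using (Bool; true; false; if_then_else_)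
open import Data.List using (List; []; _∷_; length; inits)
open import Data.List.Relation.Unary.All using (All)
open import Data.Product using (_×_)
open import Relation.Binary.PropositionalEquality using (_≡_)

-- Steps of a lattice path: U = up step (1,1), D = down step (1,1-k).
data Step : Set where
  U D : Step

#U : List Step → ℕ
#U []       = 0
#U (U ∷ s)  = suc (#U s)
#U (D ∷ s)  = #U s

#D : List Step → ℕ
#D []       = 0
#D (U ∷ s)  = #D s
#D (D ∷ s)  = suc (#D s)

NonNegPrefix : ℕ → List Step → Set
NonNegPrefix k p = (k ∸ 1) * #D p ≤ #U p

-- k-Catalan path of order n: (k-1)n up steps, n down steps (hence length kn,
-- ending at height 0), never going below the x-axis.
IsKCatalanPath : ℕ → ℕ → List Step → Set
IsKCatalanPath k n P =
  (#U P ≡ (k ∸ 1) * n) × (#D P ≡ n) × All (NonNegPrefix k) (inits P)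

upLevelsFrom : ℕ → ℕ → List Step → List ℕ
upLevelsFrom k h []      = []
upLevelsFrom k h (U ∷ s) = h ∷ upLevelsFrom k (suc h) s
upLevelsFrom k h (D ∷ s) = upLevelsFrom k (h ∸ (k ∸ 1)) s

upLevels : ℕ → List Step → List ℕ
upLevels k = upLevelsFrom k 0

countLess : ℕ → List ℕ → ℕ
countLess l []       = 0
countLess l (x ∷ xs) = if x <ᵇ l then suc (countLess l xs) else countLess l xs

countEq : ℕ → List ℕ → ℕ
countEq l []       = 0
countEq l (x ∷ xs) = if x ≡ᵇ l then suc (countEq l xs) else countEq l xs

-- The (unique) labelling of the up steps by 1..(k-1)n such that every lower
-- level gets smaller labels than every higher level, and labels increase from
-- right to left within a level: the up step at level l gets label
--   #(up steps at level < l) + #(up steps at level l to its right) + 1.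
-- Labels are recorded in the order the up steps occur.
labelsFrom : List ℕ → List ℕ → List ℕ
labelsFrom all []         = []
labelsFrom all (l ∷ rest) = suc (countLess l all + countEq l rest) ∷ labelsFrom all rest

shortSpitzerPerm : ℕ → List Step → List ℕ
shortSpitzerPerm k P = labelsFrom (upLevels k P) (upLevels k P)

{-# OPTIONS --safe #-}
-- The permutation determines the sequence of levels of the up steps, and the
-- levels determine the path.  The levels of a path start at 0 and rise by at
-- most one per up step, so at the first position where two level sequences
-- differ, the smaller level x has already occurred.  In one permutation the
-- new x is labelled below the earlier x (same level, further right), in the
-- other the new entry is labelled above the earlier x (higher level); since
-- the earlier labels agree, the new ones cannot.  For the second part, an up
-- step at height h has level h, while after a down step (which needs h ≥ k-1)
-- every level is at most h - (k-1) < h.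
module Submission where

open import Defs
open import Data.Nat using (ℕ; suc; _+_; _*_; _∸_; _≤_; _<_; _<ᵇ_; _≡ᵇ_; _≤′_; ≤′-reflexive; ≤′-step; s≤s)
open import Data.Nat.Properties
open import Data.Bool using (true; false)
open import Data.List using (List; []; _∷_; length; inits; _++_; [_])
open import Data.List.Properties using (∷-injectiveˡ; ∷-injectiveʳ; ++-assoc)
open import Data.List.Relation.Unary.All using (All; []; _∷_)
import Data.List.Relation.Unary.All as All
open import Data.List.Relation.Unary.All.Properties using (map⁻)
open import Data.List.Membership.Propositional using (_∈_)
open import Data.List.Membership.Propositional.Properties using (∈-∃++; ∈-++⁺ˡ; ∈-++⁺ʳ)
open import Data.List.Relation.Unary.Any using (here)
open import Data.Product using (_,_)
open import Data.Sum using (inj₁; inj₂)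
open import Data.Empty using (⊥-elim)
open import Relation.Binary using (tri<; tri≈; tri>)
open import Relation.Binary.PropositionalEquality hiding ([_])

countLess-∷-< : ∀ {z l} zs → z < l → countLess l (z ∷ zs) ≡ suc (countLess l zs)
countLess-∷-< {z} {l} zs z<l with z <ᵇ l | <⇒<ᵇ z<l
... | true | _ = refl

countLess-∷-≥ : ∀ {z l} zs → l ≤ z → countLess l (z ∷ zs) ≡ countLess l zs
countLess-∷-≥ {z} {l} zs l≤z with z <ᵇ l | <ᵇ⇒< z l
... | true  | z<l = ⊥-elim (≤⇒≯ l≤z (z<l _))
... | false | _   = refl

countEq-∷-≡ : ∀ l zs → countEq l (l ∷ zs) ≡ suc (countEq l zs)
countEq-∷-≡ l zs with l ≡ᵇ l | ≡⇒≡ᵇ l l refl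
... | true | _ = refl

countEq-∷-≢ : ∀ {z l} zs → z ≢ l → countEq l (z ∷ zs) ≡ countEq l zs
countEq-∷-≢ {z} {l} zs z≢l with z ≡ᵇ l | ≡ᵇ⇒≡ z l
... | true  | z≡l = ⊥-elim (z≢l (z≡l _))
... | false | _   = refl

countLess-suc : ∀ l zs → countLess (suc l) zs ≡ countLess l zs + countEq l zs
countLess-suc l [] = refl
countLess-suc l (z ∷ zs) with <-cmp z l
... | tri< z<l z≢l _ = begin
  countLess (suc l) (z ∷ zs)               ≡⟨ countLess-∷-< zs (m<n⇒m<1+n z<l) ⟩
  suc (countLess (suc l) zs)               ≡⟨ cong suc (countLess-suc l zs) ⟩
  suc (countLess l zs + countEq l zs)      ≡⟨ cong₂ _+_ (countLess-∷-< zs z<l) (countEq-∷-≢ zs z≢l) ⟨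
  countLess l (z ∷ zs) + countEq l (z ∷ zs) ∎
  where open ≡-Reasoning
... | tri≈ _ refl _ = begin
  countLess (suc z) (z ∷ zs)               ≡⟨ countLess-∷-< zs (n<1+n z) ⟩
  suc (countLess (suc z) zs)               ≡⟨ cong suc (countLess-suc z zs) ⟩
  suc (countLess z zs + countEq z zs)      ≡⟨ +-suc (countLess z zs) (countEq z zs) ⟨
  countLess z zs + suc (countEq z zs)      ≡⟨ cong₂ _+_ (countLess-∷-≥ zs ≤-refl) (countEq-∷-≡ z zs) ⟨
  countLess z (z ∷ zs) + countEq z (z ∷ zs) ∎
  where open ≡-Reasoning
... | tri> _ z≢l l<z = begin
  countLess (suc l) (z ∷ zs)               ≡⟨ countLess-∷-≥ zs l<z ⟩
  countLess (suc l) zs                     ≡⟨ countLess-suc l zs ⟩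
  countLess l zs + countEq l zs            ≡⟨ cong₂ _+_ (countLess-∷-≥ zs (<⇒≤ l<z)) (countEq-∷-≢ zs z≢l) ⟨
  countLess l (z ∷ zs) + countEq l (z ∷ zs) ∎
  where open ≡-Reasoning

countLess-mono-≤ : ∀ {l l′} zs → l ≤′ l′ → countLess l zs ≤ countLess l′ zs
countLess-mono-≤ zs (≤′-reflexive refl) = ≤-refl
countLess-mono-≤ {l} {suc l′} zs (≤′-step l≤′l′) = begin
  countLess l zs                  ≤⟨ countLess-mono-≤ zs l≤′l′ ⟩
  countLess l′ zs                 ≤⟨ m≤m+n _ _ ⟩
  countLess l′ zs + countEq l′ zs ≡⟨ countLess-suc l′ zs ⟨
  countLess (suc l′) zs           ∎
  where open ≤-Reasoning

countEq-++ : ∀ l zs ys → countEq l ys ≤ countEq l (zs ++ ys)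
countEq-++ l [] ys = ≤-refl
countEq-++ l (z ∷ zs) ys with z ≡ᵇ l
... | true  = m≤n⇒m≤1+n (countEq-++ l zs ys)
... | false = countEq-++ l zs ys

countEq-++-∷ : ∀ l zs ys → countEq l ys < countEq l (zs ++ l ∷ ys)
countEq-++-∷ l zs ys = begin-strict
  countEq l ys             <⟨ n<1+n _ ⟩
  suc (countEq l ys)       ≡⟨ countEq-∷-≡ l ys ⟨
  countEq l (l ∷ ys)       ≤⟨ countEq-++ l zs (l ∷ ys) ⟩
  countEq l (zs ++ l ∷ ys) ∎
  where open ≤-Reasoning

label : List ℕ → ℕ → List ℕ → ℕ
label levels l later = suc (countLess l levels + countEq l later)

label-<-sameLevel : ∀ levels l zs ys → label levels l ys < label levels l (zs ++ l ∷ ys)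
label-<-sameLevel levels l zs ys = s≤s (+-monoʳ-< (countLess l levels) (countEq-++-∷ l zs ys))

label-<-higherLevel : ∀ zs {l l′} ys ys′ → l < l′ →
  label (zs ++ l ∷ ys) l ys < label (zs ++ l ∷ ys) l′ ys′
label-<-higherLevel zs {l} {l′} ys ys′ l<l′ = s≤s (begin-strict
  countLess l levels + countEq l ys     <⟨ +-monoʳ-< (countLess l levels) (countEq-++-∷ l zs ys) ⟩
  countLess l levels + countEq l levels ≡⟨ countLess-suc l levels ⟨
  countLess (suc l) levels              ≤⟨ countLess-mono-≤ levels (≤⇒≤′ l<l′) ⟩
  countLess l′ levels                   ≤⟨ m≤m+n _ _ ⟩
  countLess l′ levels + countEq l′ ys′  ∎)
  where
  open ≤-Reasoning
  levels : List ℕ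
  levels = zs ++ l ∷ ys

labelsFrom-++-cancelˡ : ∀ {levels levels′} zs {ys ys′} →
  labelsFrom levels (zs ++ ys) ≡ labelsFrom levels′ (zs ++ ys′) →
  labelsFrom levels ys ≡ labelsFrom levels′ ys′
labelsFrom-++-cancelˡ []       eq = eq
labelsFrom-++-cancelˡ (_ ∷ zs) eq = labelsFrom-++-cancelˡ zs (∷-injectiveʳ eq)

labelsFrom-≢-at-repeated-lower-level : ∀ pre {l l′} ys ys′ → l < l′ → l ∈ pre →
  labelsFrom (pre ++ l ∷ ys) (pre ++ l ∷ ys) ≢ labelsFrom (pre ++ l′ ∷ ys′) (pre ++ l′ ∷ ys′)
labelsFrom-≢-at-repeated-lower-level pre {l} {l′} ys ys′ l<l′ l∈pre eq
  with as , bs , refl ← ∈-∃++ l∈pre = <-irrefl refl (begin-strict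
  label levels l ys                  <⟨ label-<-sameLevel levels l bs ys ⟩
  label levels l (bs ++ l ∷ ys)      ≡⟨ ∷-injectiveˡ eq-from-repeat ⟩
  label levels′ l (bs ++ l′ ∷ ys′)   <⟨ label-<-higherLevel as (bs ++ l′ ∷ ys′) ys′ l<l′ ⟩
  label levels′ l′ ys′               ≡⟨ ∷-injectiveˡ eq-from-divergence ⟨
  label levels l ys                  ∎)
  where
  open ≤-Reasoning
  levels levels′ : List ℕ
  levels  = as ++ l ∷ bs ++ l ∷ ys
  levels′ = as ++ l ∷ bs ++ l′ ∷ ys′
  eq-assoc : labelsFrom levels levels ≡ labelsFrom levels′ levels′
  eq-assoc = subst₂ (λ u v → labelsFrom u u ≡ labelsFrom v v)
    (++-assoc as (l ∷ bs) (l ∷ ys)) (++-assoc as (l ∷ bs) (l′ ∷ ys′)) eq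
  eq-from-repeat : labelsFrom levels (l ∷ bs ++ l ∷ ys) ≡ labelsFrom levels′ (l ∷ bs ++ l′ ∷ ys′)
  eq-from-repeat = labelsFrom-++-cancelˡ as eq-assoc
  eq-from-divergence : labelsFrom levels (l ∷ ys) ≡ labelsFrom levels′ (l′ ∷ ys′)
  eq-from-divergence = labelsFrom-++-cancelˡ bs (∷-injectiveʳ eq-from-repeat)

data RisesByAtMostOne : ℕ → List ℕ → Set where
  []  : ∀ {m} → RisesByAtMostOne m []
  _∷_ : ∀ {m l ls} → l ≤ m → RisesByAtMostOne (suc l) ls → RisesByAtMostOne m (l ∷ ls)

RisesByAtMostOne-weaken : ∀ {m m′ ls} → m ≤ m′ → RisesByAtMostOne m ls → RisesByAtMostOne m′ ls
RisesByAtMostOne-weaken m≤m′ []           = []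
RisesByAtMostOne-weaken m≤m′ (l≤m ∷ rise) = ≤-trans l≤m m≤m′ ∷ rise

labelsFrom-determines-rising : ∀ pre {m} ls ls′ → (∀ {l} → l < m → l ∈ pre) →
  RisesByAtMostOne m ls → RisesByAtMostOne m ls′ → length ls ≡ length ls′ →
  labelsFrom (pre ++ ls) (pre ++ ls) ≡ labelsFrom (pre ++ ls′) (pre ++ ls′) → ls ≡ ls′
labelsFrom-determines-rising pre [] [] seen _ _ _ _ = refl
labelsFrom-determines-rising pre (l ∷ ls) (l′ ∷ ls′) seen (l≤m ∷ rise) (l′≤m ∷ rise′) len eq
  with <-cmp l l′
... | tri< l<l′ _ _ = ⊥-elim
  (labelsFrom-≢-at-repeated-lower-level pre ls ls′ l<l′ (seen (<-≤-trans l<l′ l′≤m)) eq)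
... | tri> _ _ l′<l = ⊥-elim
  (labelsFrom-≢-at-repeated-lower-level pre ls′ ls l′<l (seen (<-≤-trans l′<l l≤m)) (sym eq))
... | tri≈ _ refl _ = cong (l ∷_)
  (labelsFrom-determines-rising (pre ++ [ l ]) ls ls′ seen′ rise rise′ (suc-injective len) eq′)
  where
  seen′ : ∀ {v} → v < suc l → v ∈ pre ++ [ l ]
  seen′ v<1+l with m<1+n⇒m<n∨m≡n v<1+l
  ... | inj₁ v<l  = ∈-++⁺ˡ (seen (<-≤-trans v<l l≤m))
  ... | inj₂ refl = ∈-++⁺ʳ pre (here refl)
  eq′ : labelsFrom ((pre ++ [ l ]) ++ ls) ((pre ++ [ l ]) ++ ls)
      ≡ labelsFrom ((pre ++ [ l ]) ++ ls′) ((pre ++ [ l ]) ++ ls′)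
  eq′ = subst₂ (λ u v → labelsFrom u u ≡ labelsFrom v v)
    (sym (++-assoc pre [ l ] ls)) (sym (++-assoc pre [ l ] ls′)) eq

upLevelsFrom-rises : ∀ k h P → RisesByAtMostOne h (upLevelsFrom k h P)
upLevelsFrom-rises k h []      = []
upLevelsFrom-rises k h (U ∷ P) = ≤-refl ∷ upLevelsFrom-rises k (suc h) P
upLevelsFrom-rises k h (D ∷ P) =
  RisesByAtMostOne-weaken (m∸n≤m h (k ∸ 1)) (upLevelsFrom-rises k (h ∸ (k ∸ 1)) P)

length-upLevelsFrom : ∀ k h P → length (upLevelsFrom k h P) ≡ #U P
length-upLevelsFrom k h []      = refl
length-upLevelsFrom k h (U ∷ P) = cong suc (length-upLevelsFrom k (suc h) P)
length-upLevelsFrom k h (D ∷ P) = length-upLevelsFrom k (h ∸ (k ∸ 1)) P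

shortSpitzerPerm-determines-upLevels : ∀ k P Q → #U P ≡ #U Q →
  shortSpitzerPerm k P ≡ shortSpitzerPerm k Q → upLevels k P ≡ upLevels k Q
shortSpitzerPerm-determines-upLevels k P Q #UP≡#UQ =
  labelsFrom-determines-rising [] (upLevels k P) (upLevels k Q) (λ ())
    (upLevelsFrom-rises k 0 P) (upLevelsFrom-rises k 0 Q)
    (trans (length-upLevelsFrom k 0 P) (trans #UP≡#UQ (sym (length-upLevelsFrom k 0 Q))))

data StaysAboveAxis (c : ℕ) : ℕ → List Step → Set where
  []   : ∀ {h} → StaysAboveAxis c h []
  up   : ∀ {h P} → StaysAboveAxis c (suc h) P → StaysAboveAxis c h (U ∷ P)
  down : ∀ {h P} → c ≤ h → StaysAboveAxis c (h ∸ c) P → StaysAboveAxis c h (D ∷ P)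

staysAboveAxis : ∀ c h P → All (λ p → c * #D p ≤ h + #U p) (inits P) → StaysAboveAxis c h P
staysAboveAxis c h []      _ = []
staysAboveAxis c h (U ∷ P) (_ ∷ above) = up (staysAboveAxis c (suc h) P
  (All.map (λ {p} le → ≤-trans le (≤-reflexive (+-suc h (#U p)))) (map⁻ above)))
staysAboveAxis c h (D ∷ P) (_ ∷ above) with first ∷ rest ← map⁻ above =
  down c≤h (staysAboveAxis c (h ∸ c) P (lower [] first ∷ All.map (λ {p} → lower p) rest))
  where
  c≤h : c ≤ h
  c≤h = subst₂ _≤_ (*-identityʳ c) (+-identityʳ h) first
  lower : ∀ p → c * suc (#D p) ≤ h + #U p → c * #D p ≤ h ∸ c + #U p
  lower p le = +-cancelˡ-≤ c _ _ (begin
    c + c * #D p         ≡⟨ *-suc c (#D p) ⟨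
    c * suc (#D p)       ≤⟨ le ⟩
    h + #U p             ≡⟨ cong (_+ #U p) (m+[n∸m]≡n c≤h) ⟨
    c + (h ∸ c) + #U p   ≡⟨ +-assoc c (h ∸ c) (#U p) ⟩
    c + (h ∸ c + #U p)   ∎)
    where open ≤-Reasoning

upLevelsFrom-head-≤ : ∀ k h P {l ls} → upLevelsFrom k h P ≡ l ∷ ls → l ≤ h
upLevelsFrom-head-≤ k h P eq
  with l≤h ∷ _ ← subst (RisesByAtMostOne h) eq (upLevelsFrom-rises k h P) = l≤h

upLevelsFrom-up≢down : ∀ k → 2 ≤ k → ∀ {h} → k ∸ 1 ≤ h → ∀ P Q →
  upLevelsFrom k h (U ∷ P) ≢ upLevelsFrom k h (D ∷ Q)
upLevelsFrom-up≢down k k≥2 {h} c≤h P Q eq =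
  <⇒≱ (∸-monoʳ-< (∸-monoˡ-≤ 1 k≥2) c≤h) (upLevelsFrom-head-≤ k (h ∸ (k ∸ 1)) Q (sym eq))

upLevelsFrom-injective : ∀ k → 2 ≤ k → ∀ h P Q →
  StaysAboveAxis (k ∸ 1) h P → StaysAboveAxis (k ∸ 1) h Q → #D P ≡ #D Q →
  upLevelsFrom k h P ≡ upLevelsFrom k h Q → P ≡ Q
upLevelsFrom-injective k k≥2 h [] [] _ _ _ _ = refl
upLevelsFrom-injective k k≥2 h [] (D ∷ Q) _ _ () _
upLevelsFrom-injective k k≥2 h (D ∷ P) [] _ _ () _
upLevelsFrom-injective k k≥2 h (U ∷ P) (U ∷ Q) (up P↑) (up Q↑) #D≡ lv≡ =
  cong (U ∷_) (upLevelsFrom-injective k k≥2 (suc h) P Q P↑ Q↑ #D≡ (∷-injectiveʳ lv≡))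
upLevelsFrom-injective k k≥2 h (D ∷ P) (D ∷ Q) (down _ P↑) (down _ Q↑) #D≡ lv≡ =
  cong (D ∷_) (upLevelsFrom-injective k k≥2 (h ∸ (k ∸ 1)) P Q P↑ Q↑ (suc-injective #D≡) lv≡)
upLevelsFrom-injective k k≥2 h (U ∷ P) (D ∷ Q) _ (down c≤h _) _ lv≡ =
  ⊥-elim (upLevelsFrom-up≢down k k≥2 c≤h P Q lv≡)
upLevelsFrom-injective k k≥2 h (D ∷ P) (U ∷ Q) (down c≤h _) _ _ lv≡ =
  ⊥-elim (upLevelsFrom-up≢down k k≥2 c≤h Q P (sym lv≡))

proposition4p9 : (k n : ℕ) → 2 ≤ k → (P Q : List Step) →
    IsKCatalanPath k n P → IsKCatalanPath k n Q →
    shortSpitzerPerm k P ≡ shortSpitzerPerm k Q → P ≡ Q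
proposition4p9 k n k≥2 P Q (#UP , #DP , P↑) (#UQ , #DQ , Q↑) σ≡ =
  upLevelsFrom-injective k k≥2 0 P Q
    (staysAboveAxis (k ∸ 1) 0 P P↑) (staysAboveAxis (k ∸ 1) 0 Q Q↑)
    (trans #DP (sym #DQ))
    (shortSpitzerPerm-determines-upLevels k P Q (trans #UP (sym #UQ)) σ≡)
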